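{- Let $\Gamma$ be a context and $A$ a type. If for every possible-world model $\mathcal{M}$ with a reflexive–transitive frame the type $\forall w.\,\llbracket\Gamma\rrbracket_w\to\llbracket A\rrbracket_w$ is inhabited, then there is a term $t:\Gamma\vdash A$ of IS4C.
   Context: Metalanguage: constructive type theory with universe $\mathsf{Type}$. Types $A,B::=\iota\mid A\Rightarrow B\mid\Box A$; contexts $\Gamma::=\cdot\mid\Gamma,A\mid\Gamma,\blacksquare$ ($\blacksquare$ a lock). IS4C terms: de Bruijn variables ($\mathsf{zero}:(\Gamma,A)\vdash_{var}A$, $\mathsf{succ}\,v:(\Gamma,B)\vdash_{var}A$; no variable passes a lock); $\lambda$-abstraction and application as in simply typed lambda calculus; $\Gamma\vdash\mathsf{box}\,t:\Box A$ for $(\Gamma,\blacksquare)\vdash t:A$; $\Gamma\vdash\mathsf{unbox}(t,e):A$ for $\Delta\vdash t:\Box A$ and $e:\Delta\lhd\Gamma$, where $\Delta\lhd\Gamma$ is generated by $\mathsf{nil}:\Gamma\lhd\Gamma$, $\mathsf{ext}\,e:\Delta\lhd(\Gamma,A)$ and $\mathsf{lock}\,e:\Delta\lhd(\Gamma,\blacksquare)$ for $e:\Delta\lhd\Gamma$. A possible-world model: frame $(W,R_i,R_m)$, $R_i,R_m:W\times W\to\mathsf{Type}$, $R_i$ with $\mathsf{refl}_i,\mathsf{trans}_i$ forming a category; factorization: for $m:w\,R_m\,v$, $i:v\,R_i\,v'$ a world $w'$ with $f_i(m,i):w\,R_i\,w'$, $f_m(m,i):w'\,R_m\,v'$, satisfying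 $f_i(m,\mathsf{refl}_i)=\mathsf{refl}_i$, $f_m(m,\mathsf{refl}_i)=m$, $f_i(m,\mathsf{trans}_i(i,j))=\mathsf{trans}_i(f_i(m,i),f_i(f_m(m,i),j))$, $f_m(m,\mathsf{trans}_i(i,j))=f_m(f_m(m,i),j)$; valuation $V_\iota$ with functorial $\mathsf{wk}_\iota$. The frame is reflexive–transitive if $R_m$ has $\mathsf{refl}_m,\mathsf{trans}_m$ (associative, unital) with $f_i(\mathsf{refl}_m,i)=i$, $f_m(\mathsf{refl}_m,i)=\mathsf{refl}_m$, $f_i(\mathsf{trans}_m(n,m),i)=f_i(n,f_i(m,i))$, $f_m(\mathsf{trans}_m(n,m),i)=\mathsf{trans}_m(f_m(n,f_i(m,i)),f_m(m,i))$. Interpretation: $\llbracket\iota\rrbracket_w=V_{\iota,w}$; $\llbracket A\Rightarrow B\rrbracket_w=\forall w'.w\,R_i\,w'\to\llbracket A\rrbracket_{w'}\to\llbracket B\rrbracket_{w'}$; $\llbracket\Box A\rrbracket_w=\forall w'.w\,R_i\,w'\to\forall v.w'\,R_m\,v\to\llbracket A\rrbracket_v$; $\llbracket\cdot\rrbracket_w=\top$; $\llbracket\Gamma,A\rrbracket_w=\llbracket\Gamma\rrbracket_w\times\llbracket A\rrbracket_w$; $\llbracket\Gamma,\blacksquare\rrbracket_w=\Sigma_u\llbracket\Gamma\rrbracket_u\times u\,R_m\,w$. -}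

module Defs where

open import Data.Product using (Σ; _×_; _,_; proj₁; proj₂)
open import Data.Unit using (⊤)
open import Relation.Binary.PropositionalEquality using (_≡_)

infixr 7 _⇒_
infixl 5 _,,_

data Ty : Set where
  ι   : Ty
  _⇒_ : Ty → Ty → Ty
  □_  : Ty → Ty

data Ctx : Set where
  ·    : Ctx
  _,,_ : Ctx → Ty → Ctx
  _,🔒 : Ctx → Ctx

-- de Bruijn variables (no variable passes a lock)
data Var : Ctx → Ty → Set where
  zero : ∀ {Γ A} → Var (Γ ,, A) A
  succ : ∀ {Γ A B} → Var Γ A → Var (Γ ,, B) A

data _◁_ : Ctx → Ctx → Set where
  nil  : ∀ {Γ} → Γ ◁ Γ
  ext  : ∀ {Δ Γ A} → Δ ◁ Γ → Δ ◁ (Γ ,, A)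
  lock : ∀ {Δ Γ} → Δ ◁ Γ → Δ ◁ (Γ ,🔒)

data Tm : Ctx → Ty → Set where
  var   : ∀ {Γ A} → Var Γ A → Tm Γ A
  lam   : ∀ {Γ A B} → Tm (Γ ,, A) B → Tm Γ (A ⇒ B)
  app   : ∀ {Γ A B} → Tm Γ (A ⇒ B) → Tm Γ A → Tm Γ B
  box   : ∀ {Γ A} → Tm (Γ ,🔒) A → Tm Γ (□ A)
  unbox : ∀ {Γ Δ A} → Tm Δ (□ A) → Δ ◁ Γ → Tm Γ A

-- Transitivity is written in diagrammatic order:
-- transᵢ : w Rᵢ v → v Rᵢ u → w Rᵢ u.
-- The factorization is packaged as a triple (w' , fᵢ(m,i) , fₘ(m,i)), so that
-- the equations of the paper are stated as equalities of triples (which also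
-- records the equality of the intermediate worlds needed for them to typecheck).
record Frame : Set₁ where
  field
    W      : Set
    Rᵢ     : W → W → Set
    Rₘ     : W → W → Set
    reflᵢ  : ∀ {w} → Rᵢ w w
    transᵢ : ∀ {w v u} → Rᵢ w v → Rᵢ v u → Rᵢ w u
    transᵢ-unitˡ : ∀ {w v} (i : Rᵢ w v) → transᵢ reflᵢ i ≡ i
    transᵢ-unitʳ : ∀ {w v} (i : Rᵢ w v) → transᵢ i reflᵢ ≡ i
    transᵢ-assoc : ∀ {w v u x} (i : Rᵢ w v) (j : Rᵢ v u) (k : Rᵢ u x) →
                   transᵢ (transᵢ i j) k ≡ transᵢ i (transᵢ j k)
    factor : ∀ {w v v'} → Rₘ w v → Rᵢ v v' → Σ W (λ w' → Rᵢ w w' × Rₘ w' v')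
    factor-refl  : ∀ {w v} (m : Rₘ w v) → factor m reflᵢ ≡ (w , reflᵢ , m)
    -- fᵢ(m, transᵢ(i,j)) = transᵢ(fᵢ(m,i), fᵢ(fₘ(m,i),j)),
    -- fₘ(m, transᵢ(i,j)) = fₘ(fₘ(m,i),j)
    factor-trans : ∀ {w v v' v''} (m : Rₘ w v) (i : Rᵢ v v') (j : Rᵢ v' v'') →
      factor m (transᵢ i j)
        ≡ ( proj₁ (factor (proj₂ (proj₂ (factor m i))) j)
          , transᵢ (proj₁ (proj₂ (factor m i)))
                   (proj₁ (proj₂ (factor (proj₂ (proj₂ (factor m i))) j)))
          , proj₂ (proj₂ (factor (proj₂ (proj₂ (factor m i))) j)) )

  fᵢ : ∀ {w v v'} (m : Rₘ w v) (i : Rᵢ v v') → Rᵢ w (proj₁ (factor m i))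
  fᵢ m i = proj₁ (proj₂ (factor m i))

  fₘ : ∀ {w v v'} (m : Rₘ w v) (i : Rᵢ v v') → Rₘ (proj₁ (factor m i)) v'
  fₘ m i = proj₂ (proj₂ (factor m i))

record Model : Set₁ where
  field
    frame : Frame
  open Frame frame public
  field
    Vι     : W → Set
    wkι    : ∀ {w w'} → Rᵢ w w' → Vι w → Vι w'
    wkι-refl  : ∀ {w} (x : Vι w) → wkι reflᵢ x ≡ x
    wkι-trans : ∀ {w v u} (i : Rᵢ w v) (j : Rᵢ v u) (x : Vι w) →
                wkι (transᵢ i j) x ≡ wkι j (wkι i x)

-- Reflexive–transitive frames.  transₘ is also diagrammatic:
-- transₘ : u Rₘ w → w Rₘ v → u Rₘ v   (transₘ(n,m) with n : u Rₘ w, m : w Rₘ v).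
record ReflTrans (F : Frame) : Set where
  open Frame F
  field
    reflₘ  : ∀ {w} → Rₘ w w
    transₘ : ∀ {w v u} → Rₘ w v → Rₘ v u → Rₘ w u
    transₘ-unitˡ : ∀ {w v} (m : Rₘ w v) → transₘ reflₘ m ≡ m
    transₘ-unitʳ : ∀ {w v} (m : Rₘ w v) → transₘ m reflₘ ≡ m
    transₘ-assoc : ∀ {w v u x} (m : Rₘ w v) (n : Rₘ v u) (k : Rₘ u x) →
                   transₘ (transₘ m n) k ≡ transₘ m (transₘ n k)
    factor-reflₘ  : ∀ {w v} (i : Rᵢ w v) → factor reflₘ i ≡ (v , i , reflₘ)
    -- fᵢ(transₘ(n,m), i) = fᵢ(n, fᵢ(m,i)),
    -- fₘ(transₘ(n,m), i) = transₘ(fₘ(n, fᵢ(m,i)), fₘ(m,i))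
    factor-transₘ : ∀ {u w v v'} (n : Rₘ u w) (m : Rₘ w v) (i : Rᵢ v v') →
      factor (transₘ n m) i
        ≡ ( proj₁ (factor n (fᵢ m i))
          , fᵢ n (fᵢ m i)
          , transₘ (fₘ n (fᵢ m i)) (fₘ m i) )

module _ (M : Model) where
  open Model M

  ⟦_⟧ty : Ty → W → Set
  ⟦ ι ⟧ty     w = Vι w
  ⟦ A ⇒ B ⟧ty w = ∀ w' → Rᵢ w w' → ⟦ A ⟧ty w' → ⟦ B ⟧ty w'
  ⟦ □ A ⟧ty   w = ∀ w' → Rᵢ w w' → ∀ v → Rₘ w' v → ⟦ A ⟧ty v

  ⟦_⟧ctx : Ctx → W → Set
  ⟦ · ⟧ctx      w = ⊤
  ⟦ Γ ,, A ⟧ctx w = ⟦ Γ ⟧ctx w × ⟦ A ⟧ty w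
  ⟦ Γ ,🔒 ⟧ctx  w = Σ W (λ u → ⟦ Γ ⟧ctx u × Rₘ u w)

-- Completeness via a universal model built from the syntax itself.  Its worlds
-- are contexts, intuitionistic accessibility Δ Rᵢ Γ means that Γ extends Δ by
-- variables, and modal accessibility is Δ ◁ Γ; this frame is reflexive and
-- transitive.  By induction on types, reflection turns terms into semantic
-- values and reification turns values back into terms.  Reflecting the
-- variables of Γ gives a semantic environment for Γ at world Γ, to which the
-- hypothesis applies; reifying the resulting value of A gives the term.
module Submission where

open import Defs
open import Data.Product using (Σ; _×_; _,_; proj₁; proj₂)
open import Data.Unit using (tt)
open import Relation.Binary.PropositionalEquality
  using (_≡_; refl; sym; cong; module ≡-Reasoning)

infix 4 _⊑_ _⊆_

data _⊑_ : Ctx → Ctx → Set where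
  ⊑-refl : ∀ {Γ} → Γ ⊑ Γ
  ⊑-step : ∀ {Γ Δ A} → Γ ⊑ Δ → Γ ⊑ Δ ,, A

⊑-trans : ∀ {Γ Δ Θ} → Γ ⊑ Δ → Δ ⊑ Θ → Γ ⊑ Θ
⊑-trans i ⊑-refl     = i
⊑-trans i (⊑-step j) = ⊑-step (⊑-trans i j)

⊑-trans-identityˡ : ∀ {Γ Δ} (i : Γ ⊑ Δ) → ⊑-trans ⊑-refl i ≡ i
⊑-trans-identityˡ ⊑-refl     = refl
⊑-trans-identityˡ (⊑-step i) = cong ⊑-step (⊑-trans-identityˡ i)

⊑-trans-assoc : ∀ {Γ Δ Θ Ξ} (i : Γ ⊑ Δ) (j : Δ ⊑ Θ) (k : Θ ⊑ Ξ) →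
                ⊑-trans (⊑-trans i j) k ≡ ⊑-trans i (⊑-trans j k)
⊑-trans-assoc i j ⊑-refl     = refl
⊑-trans-assoc i j (⊑-step k) = cong ⊑-step (⊑-trans-assoc i j k)

◁-trans : ∀ {Γ Δ Θ} → Γ ◁ Δ → Δ ◁ Θ → Γ ◁ Θ
◁-trans m nil      = m
◁-trans m (ext e)  = ext (◁-trans m e)
◁-trans m (lock e) = lock (◁-trans m e)

◁-trans-identityˡ : ∀ {Γ Δ} (m : Γ ◁ Δ) → ◁-trans nil m ≡ m
◁-trans-identityˡ nil      = refl
◁-trans-identityˡ (ext m)  = cong ext (◁-trans-identityˡ m)
◁-trans-identityˡ (lock m) = cong lock (◁-trans-identityˡ m)

◁-trans-assoc : ∀ {Γ Δ Θ Ξ} (m : Γ ◁ Δ) (n : Δ ◁ Θ) (k : Θ ◁ Ξ) →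
                ◁-trans (◁-trans m n) k ≡ ◁-trans m (◁-trans n k)
◁-trans-assoc m n nil      = refl
◁-trans-assoc m n (ext k)  = cong ext (◁-trans-assoc m n k)
◁-trans-assoc m n (lock k) = cong lock (◁-trans-assoc m n k)

⊑⇒◁ : ∀ {Γ Δ} → Γ ⊑ Δ → Γ ◁ Δ
⊑⇒◁ ⊑-refl     = nil
⊑⇒◁ (⊑-step i) = ext (⊑⇒◁ i)

⊑⇒◁-trans : ∀ {Γ Δ Θ} (i : Γ ⊑ Δ) (j : Δ ⊑ Θ) →
            ⊑⇒◁ (⊑-trans i j) ≡ ◁-trans (⊑⇒◁ i) (⊑⇒◁ j)
⊑⇒◁-trans i ⊑-refl     = refl
⊑⇒◁-trans i (⊑-step j) = cong ext (⊑⇒◁-trans i j)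

◁-extend : ∀ {Γ Δ Θ} → Γ ◁ Δ → Δ ⊑ Θ → Γ ◁ Θ
◁-extend m i = ◁-trans m (⊑⇒◁ i)

◁-extend-trans : ∀ {Γ Δ Θ Ξ} (m : Γ ◁ Δ) (i : Δ ⊑ Θ) (j : Θ ⊑ Ξ) →
                 ◁-extend m (⊑-trans i j) ≡ ◁-extend (◁-extend m i) j
◁-extend-trans m i j = begin
  ◁-trans m (⊑⇒◁ (⊑-trans i j))              ≡⟨ cong (◁-trans m) (⊑⇒◁-trans i j) ⟩
  ◁-trans m (◁-trans (⊑⇒◁ i) (⊑⇒◁ j))        ≡⟨ sym (◁-trans-assoc m (⊑⇒◁ i) (⊑⇒◁ j)) ⟩
  ◁-trans (◁-trans m (⊑⇒◁ i)) (⊑⇒◁ j)        ∎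
  where open ≡-Reasoning

-- The reflexive case has to be treated apart: factor-reflₘ demands that the
-- whole extension is then moved to the intuitionistic side.
factor : ∀ {Γ Δ Δ⁺} → Γ ◁ Δ → Δ ⊑ Δ⁺ → Σ Ctx (λ Γ⁺ → Γ ⊑ Γ⁺ × Γ⁺ ◁ Δ⁺)
factor nil      i = _ , i , nil
factor (ext e)  i = _ , ⊑-refl , ◁-extend (ext e) i
factor (lock e) i = _ , ⊑-refl , ◁-extend (lock e) i

factor-refl : ∀ {Γ Δ} (m : Γ ◁ Δ) → factor m ⊑-refl ≡ (Γ , ⊑-refl , m)
factor-refl nil      = refl
factor-refl (ext m)  = refl
factor-refl (lock m) = refl

factor-trans : ∀ {Γ Δ Δ⁺ Δ⁺⁺} (m : Γ ◁ Δ) (i : Δ ⊑ Δ⁺) (j : Δ⁺ ⊑ Δ⁺⁺) →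
  factor m (⊑-trans i j)
    ≡ ( proj₁ (factor (proj₂ (proj₂ (factor m i))) j)
      , ⊑-trans (proj₁ (proj₂ (factor m i)))
                (proj₁ (proj₂ (factor (proj₂ (proj₂ (factor m i))) j)))
      , proj₂ (proj₂ (factor (proj₂ (proj₂ (factor m i))) j)) )
factor-trans nil      i          j = refl
factor-trans (ext e)  ⊑-refl     j = cong (λ e⁺ → _ , ⊑-refl , e⁺) (◁-extend-trans (ext e) ⊑-refl j)
factor-trans (ext e)  (⊑-step i) j = cong (λ e⁺ → _ , ⊑-refl , e⁺) (◁-extend-trans (ext e) (⊑-step i) j)
factor-trans (lock e) ⊑-refl     j = cong (λ e⁺ → _ , ⊑-refl , e⁺) (◁-extend-trans (lock e) ⊑-refl j)
factor-trans (lock e) (⊑-step i) j = cong (λ e⁺ → _ , ⊑-refl , e⁺) (◁-extend-trans (lock e) (⊑-step i) j)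

factor-transₘ : ∀ {Γ Δ Θ Θ⁺} (n : Γ ◁ Δ) (m : Δ ◁ Θ) (i : Θ ⊑ Θ⁺) →
  factor (◁-trans n m) i
    ≡ ( proj₁ (factor n (proj₁ (proj₂ (factor m i))))
      , proj₁ (proj₂ (factor n (proj₁ (proj₂ (factor m i)))))
      , ◁-trans (proj₂ (proj₂ (factor n (proj₁ (proj₂ (factor m i))))))
                (proj₂ (proj₂ (factor m i))) )
factor-transₘ n nil i = refl
factor-transₘ n (ext e) i rewrite factor-refl n =
  cong (λ e⁺ → _ , ⊑-refl , e⁺) (◁-trans-assoc n (ext e) (⊑⇒◁ i))
factor-transₘ n (lock e) i rewrite factor-refl n =
  cong (λ e⁺ → _ , ⊑-refl , e⁺) (◁-trans-assoc n (lock e) (⊑⇒◁ i))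

termFrame : Frame
termFrame = record
  { W            = Ctx
  ; Rᵢ           = _⊑_
  ; Rₘ           = _◁_
  ; reflᵢ        = ⊑-refl
  ; transᵢ       = ⊑-trans
  ; transᵢ-unitˡ = ⊑-trans-identityˡ
  ; transᵢ-unitʳ = λ _ → refl
  ; transᵢ-assoc = ⊑-trans-assoc
  ; factor       = factor
  ; factor-refl  = factor-refl
  ; factor-trans = factor-trans
  }

termFrame-reflTrans : ReflTrans termFrame
termFrame-reflTrans = record
  { reflₘ         = nil
  ; transₘ        = ◁-trans
  ; transₘ-unitˡ  = ◁-trans-identityˡ
  ; transₘ-unitʳ  = λ _ → refl
  ; transₘ-assoc  = ◁-trans-assoc
  ; factor-reflₘ  = λ _ → refl
  ; factor-transₘ = factor-transₘ
  }

data _⊆_ : Ctx → Ctx → Set where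
  done  : · ⊆ ·
  drop  : ∀ {Γ Δ A} → Γ ⊆ Δ → Γ ⊆ Δ ,, A
  keep  : ∀ {Γ Δ A} → Γ ⊆ Δ → Γ ,, A ⊆ Δ ,, A
  keep🔒 : ∀ {Γ Δ} → Γ ⊆ Δ → Γ ,🔒 ⊆ Δ ,🔒

⊆-refl : ∀ {Γ} → Γ ⊆ Γ
⊆-refl {·}      = done
⊆-refl {Γ ,, A} = keep ⊆-refl
⊆-refl {Γ ,🔒}  = keep🔒 ⊆-refl

⊑⇒⊆ : ∀ {Γ Δ} → Γ ⊑ Δ → Γ ⊆ Δ
⊑⇒⊆ ⊑-refl     = ⊆-refl
⊑⇒⊆ (⊑-step i) = drop (⊑⇒⊆ i)

renVar : ∀ {Γ Δ A} → Γ ⊆ Δ → Var Γ A → Var Δ A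
renVar (drop ρ) v        = succ (renVar ρ v)
renVar (keep ρ) zero     = zero
renVar (keep ρ) (succ v) = succ (renVar ρ v)

◁-split : ∀ {Δ Γ Γ⁺} → Δ ◁ Γ → Γ ⊆ Γ⁺ → Σ Ctx (λ Δ⁺ → Δ ⊆ Δ⁺ × Δ⁺ ◁ Γ⁺)
◁-split nil      ρ         = _ , ρ , nil
◁-split e        (drop ρ)  with ◁-split e ρ
... | Δ⁺ , σ , e⁺ = Δ⁺ , σ , ext e⁺
◁-split (ext e)  (keep ρ)  with ◁-split e ρ
... | Δ⁺ , σ , e⁺ = Δ⁺ , σ , ext e⁺
◁-split (lock e) (keep🔒 ρ) with ◁-split e ρ
... | Δ⁺ , σ , e⁺ = Δ⁺ , σ , lock e⁺

ren : ∀ {Γ Δ A} → Γ ⊆ Δ → Tm Γ A → Tm Δ A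
ren ρ (var v)     = var (renVar ρ v)
ren ρ (lam t)     = lam (ren (keep ρ) t)
ren ρ (app t u)   = app (ren ρ t) (ren ρ u)
ren ρ (box t)     = box (ren (keep🔒 ρ) t)
ren ρ (unbox t e) with ◁-split e ρ
... | Δ⁺ , σ , e⁺ = unbox (ren σ t) e⁺

-- Base values are terms of an earlier context paired with the extension, so
-- weakening is composition in _⊑_ and functorial on the nose.
termModel : Model
termModel = record
  { frame     = termFrame
  ; Vι        = λ Γ → Σ Ctx (λ Δ → Δ ⊑ Γ × Tm Δ ι)
  ; wkι       = λ { i (Δ , j , t) → Δ , ⊑-trans j i , t }
  ; wkι-refl  = λ _ → refl
  ; wkι-trans = λ { i j (Δ , k , t) → cong (λ k⁺ → Δ , k⁺ , t) (sym (⊑-trans-assoc k i j)) }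
  }

Val : Ty → Ctx → Set
Val = ⟦ termModel ⟧ty

Env : Ctx → Ctx → Set
Env = ⟦ termModel ⟧ctx

reify   : ∀ A {Γ} → Val A Γ → Tm Γ A
reflect : ∀ A {Γ} → Tm Γ A → Val A Γ
reify ι       (Δ , i , t) = ren (⊑⇒⊆ i) t
reify (A ⇒ B) {Γ} f       = lam (reify B (f (Γ ,, A) (⊑-step ⊑-refl) (reflect A (var zero))))
reify (□ A)   {Γ} f       = box (reify A (f Γ ⊑-refl (Γ ,🔒) (lock nil)))
reflect ι       {Γ} t = Γ , ⊑-refl , t
reflect (A ⇒ B) t     = λ Δ i a → reflect B (app (ren (⊑⇒⊆ i) t) (reify A a))
reflect (□ A)   t     = λ Δ i Θ e → reflect A (unbox (ren (⊑⇒⊆ i) t) e)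

wkVal : ∀ A {Γ Δ} → Γ ⊑ Δ → Val A Γ → Val A Δ
wkVal ι       i (Θ , j , t) = Θ , ⊑-trans j i , t
wkVal (A ⇒ B) i f           = λ Θ j → f Θ (⊑-trans i j)
wkVal (□ A)   i f           = λ Θ j → f Θ (⊑-trans i j)

wkEnv : ∀ Γ {Δ Δ⁺} → Δ ⊑ Δ⁺ → Env Γ Δ → Env Γ Δ⁺
wkEnv ·        i γ           = tt
wkEnv (Γ ,, A) i (γ , a)     = wkEnv Γ i γ , wkVal A i a
wkEnv (Γ ,🔒)  i (Θ , γ , e) = Θ , γ , ◁-extend e i

idEnv : ∀ Γ → Env Γ Γ
idEnv ·        = tt
idEnv (Γ ,, A) = wkEnv Γ (⊑-step ⊑-refl) (idEnv Γ) , reflect A (var zero)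
idEnv (Γ ,🔒)  = Γ , idEnv Γ , lock nil

theorem4p4 : (Γ : Ctx) (A : Ty) →
    ((M : Model) → ReflTrans (Model.frame M) →
      ∀ w → ⟦ M ⟧ctx Γ w → ⟦ M ⟧ty A w) →
    Tm Γ A
theorem4p4 Γ A valid = reify A (valid termModel termFrame-reflTrans Γ (idEnv Γ))
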